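{- Let $\lambda,k_1,k_2,l\in\mathbb{N}$ with $k_1+k_2-\lambda\geq l$, and let $\Gamma=(P,L,I)$ be a $(\lambda,k_1,k_2,l)$-sparse rank $2$ incidence geometry. Let $B_1=(P_1,L_1,I_1)$ and $B_2=(P_2,L_2,I_2)$ be blocks of $\Gamma$ such that $P_1\cap P_2\neq\emptyset$ and $L_1\cap L_2\neq\emptyset$. Define $$I_\cup=\{i\in I: i\in (P_1\cup P_2)\times(L_1\cup L_2)\},\qquad I_\cap=\{i\in I: i\in (P_1\cap P_2)\times(L_1\cap L_2)\},$$ $B_1\cup B_2=(P_1\cup P_2,\,L_1\cup L_2,\,I_\cup)$ and $B_1\cap B_2=(P_1\cap P_2,\,L_1\cap L_2,\,I_\cap)$. Then $B_1\cup B_2$ and $B_1\cap B_2$ are also blocks of $\Gamma$.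
   Context: A rank $2$ incidence geometry is a triple $\Gamma=(P,L,I)$ with $P$ (points) and $L$ (lines) finite disjoint sets and $I\subseteq P\times L$. For $I'\subseteq I$, its support is $P(I')\times L(I')$ where $P(I')=\{p:\exists \ell,\ (p,\ell)\in I'\}$ and $L(I')=\{\ell:\exists p,\ (p,\ell)\in I'\}$. An incidence geometry $(P,L,I)$ is $(\lambda,k_1,k_2,l)$-sparse if for every nonempty $I'\subseteq I$, $\lambda|I'|\leq k_1|P(I')|+k_2|L(I')|-l$; it is $(\lambda,k_1,k_2,l)$-tight if it is sparse and $\lambda|I|=k_1|P|+k_2|L|-l$. A subgeometry of $\Gamma=(P,L,I)$ is an incidence geometry $(P',L',I')$ with $P'\subseteq P$, $L'\subseteq L$, $I'\subseteq I$ (and $I'\subseteq P'\times L'$). A block of $\Gamma$ is a subgeometry which is $(\lambda,k_1,k_2,l)$-tight. -}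

module Defs where

open import Data.Bool using (Bool; true; false; _∧_; _∨_; if_then_else_)
open import Data.Nat using (ℕ; _+_; _*_; _≤_)
open import Data.Fin using (Fin)
open import Data.Fin.Subset using (Subset; _∪_; _∩_; ∣_∣; Nonempty)
open import Data.List using (List; map; allFin)
open import Data.Nat.ListAction using (sum)
open import Data.Bool.ListAction using (any)
open import Data.Vec using (tabulate; lookup)
open import Data.Product using (_×_; ∃₂)
open import Relation.Binary.PropositionalEquality using (_≡_)

-- A rank 2 incidence geometry has point set Fin np, line set Fin nl, and an
-- incidence relation given by its characteristic function.
Inc : ℕ → ℕ → Set
Inc np nl = Fin np → Fin nl → Bool

module _ {np nl : ℕ} where

  _⊆ᴵ_ : Inc np nl → Inc np nl → Set
  I' ⊆ᴵ I = ∀ p l → I' p l ≡ true → I p l ≡ true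

  NonemptyI : Inc np nl → Set
  NonemptyI I' = ∃₂ λ p l → I' p l ≡ true

  size : Inc np nl → ℕ
  size I' = sum (map (λ p → sum (map (λ l → if I' p l then 1 else 0) (allFin nl))) (allFin np))

  pts : Inc np nl → Subset np
  pts I' = tabulate (λ p → any (λ l → I' p l) (allFin nl))

  lns : Inc np nl → Subset nl
  lns I' = tabulate (λ l → any (λ p → I' p l) (allFin np))

  -- The geometry (P', L', I') (P' ⊆ Fin np, L' ⊆ Fin nl) is (λ,k1,k2,l)-sparse:
  -- λ|J| ≤ k1|P(J)| + k2|L(J)| - l for every nonempty J ⊆ I' (integer
  -- inequality, written additively).
  Sparse : (λ' k₁ k₂ l : ℕ) → Inc np nl → Set
  Sparse λ' k₁ k₂ l I' = ∀ J → J ⊆ᴵ I' → NonemptyI J →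
    λ' * size J + l ≤ k₁ * ∣ pts J ∣ + k₂ * ∣ lns J ∣

  Tight : (λ' k₁ k₂ l : ℕ) → Subset np → Subset nl → Inc np nl → Set
  Tight λ' k₁ k₂ l P' L' I' =
    Sparse λ' k₁ k₂ l I' × (λ' * size I' + l ≡ k₁ * ∣ P' ∣ + k₂ * ∣ L' ∣)

  Subgeometry : Inc np nl → Subset np → Subset nl → Inc np nl → Set
  Subgeometry I P' L' I' =
    I' ⊆ᴵ I × (∀ p l → I' p l ≡ true → (lookup P' p ≡ true) × (lookup L' l ≡ true))

  Block : (λ' k₁ k₂ l : ℕ) → Inc np nl → Subset np → Subset nl → Inc np nl → Set
  Block λ' k₁ k₂ l I P' L' I' = Subgeometry I P' L' I' × Tight λ' k₁ k₂ l P' L' I'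

  restrict : Inc np nl → Subset np → Subset nl → Inc np nl
  restrict I P' L' p l = I p l ∧ lookup P' p ∧ lookup L' l

-- With w(P, L) = k₁|P| + k₂|L| and c(J) = λ|J| + l: cardinality of subsets is modular, so
-- w(∪) + w(∩) = w(B₁) + w(B₂); an incidence of B₁ or B₂ lies in I_∪ and one of both lies
-- in I_∩, so c(I₁) + c(I₂) ≤ c(I_∪) + c(I_∩). Tightness of the blocks turns this into
-- w(∪) + w(∩) ≤ c(I_∪) + c(I_∩), while sparsity of Γ gives c(I_∪) ≤ w(∪) and c(I_∩) ≤ w(∩)
-- (for an empty incidence set because l ≤ k₁ + k₂ and the point and line sets are
-- nonempty). Hence both bounds are equalities.
module Submission where

open import Defs
open import Data.Nat using (ℕ; _+_; _≤_)
open import Data.Fin.Subset using (Subset; _∪_; _∩_; Nonempty)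
open import Data.Product using (_×_)

open import Data.Bool using (Bool; true; false; if_then_else_)
open import Data.Bool.Properties using (T-≡)
open import Data.Bool.ListAction using (any)
open import Data.Fin using (Fin)
open import Data.Fin.Subset using (_∈_; _⊆_; ∣_∣)
open import Data.Fin.Subset.Properties
  using (p⊆q⇒∣p∣≤∣q∣; x∈p⇒∣p-x∣<∣p∣; p⊆p∪q; q⊆p∪q; p∩q⊆p; x∈p∩q⁺)
open import Data.List using (List; []; _∷_; map; allFin)
open import Data.List.Relation.Unary.Any using (satisfied)
open import Data.List.Relation.Unary.Any.Properties using (any⁻)
open import Data.Nat using (zero; suc; _*_; _<_; z≤n; s≤s; z<s)
open import Data.Nat.ListAction using (sum)
open import Data.Nat.Properties
open import Algebra.Properties.CommutativeSemigroup +-commutativeSemigroup using (interchange)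
open import Data.Product using (_,_; proj₁; proj₂; ∃; map₂)
open import Data.Sum using (_⊎_; inj₁; inj₂)
open import Data.Vec using ([]; _∷_; lookup)
open import Data.Vec.Properties using (lookup∘tabulate; []=⇒lookup; lookup⇒[]=)
open import Function.Bundles using (Equivalence)
open import Relation.Binary.PropositionalEquality
  using (_≡_; refl; sym; trans; cong; cong₂; subst; module ≡-Reasoning)

∣p∪q∣+∣p∩q∣≡∣p∣+∣q∣ : ∀ {n} (p q : Subset n) → ∣ p ∪ q ∣ + ∣ p ∩ q ∣ ≡ ∣ p ∣ + ∣ q ∣
∣p∪q∣+∣p∩q∣≡∣p∣+∣q∣ []          []          = refl
∣p∪q∣+∣p∩q∣≡∣p∣+∣q∣ (false ∷ p) (false ∷ q) = ∣p∪q∣+∣p∩q∣≡∣p∣+∣q∣ p q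
∣p∪q∣+∣p∩q∣≡∣p∣+∣q∣ (false ∷ p) (true ∷ q)  =
  trans (cong suc (∣p∪q∣+∣p∩q∣≡∣p∣+∣q∣ p q)) (sym (+-suc _ _))
∣p∪q∣+∣p∩q∣≡∣p∣+∣q∣ (true ∷ p)  (false ∷ q) = cong suc (∣p∪q∣+∣p∩q∣≡∣p∣+∣q∣ p q)
∣p∪q∣+∣p∩q∣≡∣p∣+∣q∣ (true ∷ p)  (true ∷ q)  =
  cong suc (trans (+-suc _ _) (trans (cong suc (∣p∪q∣+∣p∩q∣≡∣p∣+∣q∣ p q)) (sym (+-suc _ _))))

x∈p⇒0<∣p∣ : ∀ {n} {x : Fin n} {p : Subset n} → x ∈ p → 0 < ∣ p ∣
x∈p⇒0<∣p∣ x∈p = m<n⇒0<n (x∈p⇒∣p-x∣<∣p∣ x∈p)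

lookup⇒∈ : ∀ {n} {x : Fin n} (p : Subset n) → lookup p x ≡ true → x ∈ p
lookup⇒∈ {x = x} p = lookup⇒[]= x p

module _ {n : ℕ} (p q : Subset n) {x : Fin n} where

  lookup-∪ˡ : lookup p x ≡ true → lookup (p ∪ q) x ≡ true
  lookup-∪ˡ e = []=⇒lookup (p⊆p∪q q (lookup⇒∈ p e))

  lookup-∪ʳ : lookup q x ≡ true → lookup (p ∪ q) x ≡ true
  lookup-∪ʳ e = []=⇒lookup (q⊆p∪q p q (lookup⇒∈ q e))

  lookup-∩ : lookup p x ≡ true → lookup q x ≡ true → lookup (p ∩ q) x ≡ true
  lookup-∩ e f = []=⇒lookup (x∈p∩q⁺ (lookup⇒∈ p e , lookup⇒∈ q f))

any-witness : ∀ {A : Set} (f : A → Bool) (xs : List A) →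
              any f xs ≡ true → ∃ λ x → f x ≡ true
any-witness f xs h =
  map₂ (Equivalence.to T-≡) (satisfied (any⁻ f xs (Equivalence.from T-≡ h)))

module _ {A : Set} where

  sum-map-+-mono : (f g h k : A → ℕ) → (∀ x → f x + g x ≤ h x + k x) → ∀ xs →
                   sum (map f xs) + sum (map g xs) ≤ sum (map h xs) + sum (map k xs)
  sum-map-+-mono f g h k le []       = z≤n
  sum-map-+-mono f g h k le (x ∷ xs) = begin
    (f x + sum (map f xs)) + (g x + sum (map g xs)) ≡⟨ interchange (f x) _ (g x) _ ⟩
    (f x + g x) + (sum (map f xs) + sum (map g xs)) ≤⟨ +-mono-≤ (le x) (sum-map-+-mono f g h k le xs) ⟩
    (h x + k x) + (sum (map h xs) + sum (map k xs)) ≡⟨ interchange (h x) (k x) _ _ ⟩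
    (h x + sum (map h xs)) + (k x + sum (map k xs)) ∎
    where open ≤-Reasoning

  sum-map-pos : (f : A → ℕ) (xs : List A) → 0 < sum (map f xs) → ∃ λ x → 0 < f x
  sum-map-pos f (x ∷ xs) pos with f x in eq
  ... | zero  = sum-map-pos f xs pos
  ... | suc _ = x , subst (0 <_) (sym eq) z<s

indicator : Bool → ℕ
indicator b = if b then 1 else 0

indicator-pos : ∀ {b} → 0 < indicator b → b ≡ true
indicator-pos {true} _ = refl

indicator-+-mono : ∀ a b u n → (a ≡ true → u ≡ true) → (b ≡ true → u ≡ true) →
                   (a ≡ true → b ≡ true → n ≡ true) →
                   indicator a + indicator b ≤ indicator u + indicator n
indicator-+-mono false false u n _  _  _  = z≤n
indicator-+-mono true  false u n au _  _  rewrite au refl = s≤s z≤n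
indicator-+-mono false true  u n _  bu _  rewrite bu refl = s≤s z≤n
indicator-+-mono true  true  u n au _  abn rewrite au refl | abn refl refl = ≤-refl

weight-mono : ∀ k₁ k₂ {a b c d} → a ≤ c → b ≤ d → k₁ * a + k₂ * b ≤ k₁ * c + k₂ * d
weight-mono k₁ k₂ a≤c b≤d = +-mono-≤ (*-monoʳ-≤ k₁ a≤c) (*-monoʳ-≤ k₂ b≤d)

weight-modular : ∀ k₁ k₂ {n m} (P₁ P₂ : Subset n) (L₁ L₂ : Subset m) →
  (k₁ * ∣ P₁ ∪ P₂ ∣ + k₂ * ∣ L₁ ∪ L₂ ∣) + (k₁ * ∣ P₁ ∩ P₂ ∣ + k₂ * ∣ L₁ ∩ L₂ ∣)
  ≡ (k₁ * ∣ P₁ ∣ + k₂ * ∣ L₁ ∣) + (k₁ * ∣ P₂ ∣ + k₂ * ∣ L₂ ∣)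
weight-modular k₁ k₂ P₁ P₂ L₁ L₂ = begin
  (k₁ * ∣ P₁ ∪ P₂ ∣ + k₂ * ∣ L₁ ∪ L₂ ∣) + (k₁ * ∣ P₁ ∩ P₂ ∣ + k₂ * ∣ L₁ ∩ L₂ ∣)
    ≡⟨ interchange (k₁ * ∣ P₁ ∪ P₂ ∣) _ _ _ ⟩
  (k₁ * ∣ P₁ ∪ P₂ ∣ + k₁ * ∣ P₁ ∩ P₂ ∣) + (k₂ * ∣ L₁ ∪ L₂ ∣ + k₂ * ∣ L₁ ∩ L₂ ∣)
    ≡⟨ cong₂ _+_ (sym (*-distribˡ-+ k₁ ∣ P₁ ∪ P₂ ∣ _)) (sym (*-distribˡ-+ k₂ ∣ L₁ ∪ L₂ ∣ _)) ⟩
  k₁ * (∣ P₁ ∪ P₂ ∣ + ∣ P₁ ∩ P₂ ∣) + k₂ * (∣ L₁ ∪ L₂ ∣ + ∣ L₁ ∩ L₂ ∣)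
    ≡⟨ cong₂ (λ p q → k₁ * p + k₂ * q) (∣p∪q∣+∣p∩q∣≡∣p∣+∣q∣ P₁ P₂) (∣p∪q∣+∣p∩q∣≡∣p∣+∣q∣ L₁ L₂) ⟩
  k₁ * (∣ P₁ ∣ + ∣ P₂ ∣) + k₂ * (∣ L₁ ∣ + ∣ L₂ ∣)
    ≡⟨ cong₂ _+_ (*-distribˡ-+ k₁ ∣ P₁ ∣ _) (*-distribˡ-+ k₂ ∣ L₁ ∣ _) ⟩
  (k₁ * ∣ P₁ ∣ + k₁ * ∣ P₂ ∣) + (k₂ * ∣ L₁ ∣ + k₂ * ∣ L₂ ∣)
    ≡⟨ interchange (k₁ * ∣ P₁ ∣) _ _ _ ⟩
  (k₁ * ∣ P₁ ∣ + k₂ * ∣ L₁ ∣) + (k₁ * ∣ P₂ ∣ + k₂ * ∣ L₂ ∣) ∎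
  where open ≡-Reasoning

affine-+-mono : ∀ λ' l {a b c d} → a + b ≤ c + d →
                (λ' * a + l) + (λ' * b + l) ≤ (λ' * c + l) + (λ' * d + l)
affine-+-mono λ' l {a} {b} {c} {d} le = begin
  (λ' * a + l) + (λ' * b + l) ≡⟨ interchange (λ' * a) l _ l ⟩
  (λ' * a + λ' * b) + (l + l) ≡⟨ cong (_+ (l + l)) (*-distribˡ-+ λ' a b) ⟨
  λ' * (a + b) + (l + l)      ≤⟨ +-monoˡ-≤ (l + l) (*-monoʳ-≤ λ' le) ⟩
  λ' * (c + d) + (l + l)      ≡⟨ cong (_+ (l + l)) (*-distribˡ-+ λ' c d) ⟩
  (λ' * c + λ' * d) + (l + l) ≡⟨ interchange (λ' * c) _ l l ⟩
  (λ' * c + l) + (λ' * d + l) ∎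
  where open ≤-Reasoning

squeeze : ∀ {x y a b} → x ≤ a → y ≤ b → a + b ≤ x + y → x ≡ a × y ≡ b
squeeze {x} {y} {a} {b} x≤a y≤b a+b≤x+y =
  ≤-antisym x≤a (+-cancelʳ-≤ b a x (≤-trans a+b≤x+y (+-monoʳ-≤ x y≤b))) ,
  ≤-antisym y≤b (+-cancelˡ-≤ a b y (≤-trans a+b≤x+y (+-monoˡ-≤ y x≤a)))

module _ {np nl : ℕ} where

  size-+-mono : (A B C D : Inc np nl) →
    (∀ p l → indicator (A p l) + indicator (B p l) ≤ indicator (C p l) + indicator (D p l)) →
    size A + size B ≤ size C + size D
  size-+-mono A B C D le =
    sum-map-+-mono _ _ _ _ (λ p → sum-map-+-mono _ _ _ _ (le p) (allFin nl)) (allFin np)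

  size≡0⊎NonemptyI : (J : Inc np nl) → size J ≡ 0 ⊎ NonemptyI J
  size≡0⊎NonemptyI J with size J in eq
  ... | zero  = inj₁ refl
  ... | suc _ with sum-map-pos _ (allFin np) (subst (0 <_) (sym eq) z<s)
  ...   | p , pos with sum-map-pos _ (allFin nl) pos
  ...     | l , pos′ = inj₂ (p , l , indicator-pos pos′)

  pts-⊆ : (J : Inc np nl) (P : Subset np) →
          (∀ p l → J p l ≡ true → lookup P p ≡ true) → pts J ⊆ P
  pts-⊆ J P inP {p} p∈ =
    let l , e = any-witness (J p) (allFin nl)
                  (trans (sym (lookup∘tabulate _ p)) ([]=⇒lookup p∈))
    in lookup⇒∈ P (inP p l e)

  lns-⊆ : (J : Inc np nl) (L : Subset nl) →
          (∀ p l → J p l ≡ true → lookup L l ≡ true) → lns J ⊆ L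
  lns-⊆ J L inL {l} l∈ =
    let p , e = any-witness (λ p → J p l) (allFin np)
                  (trans (sym (lookup∘tabulate _ l)) ([]=⇒lookup l∈))
    in lookup⇒∈ L (inL p l e)

  Sparse-⊆ : ∀ {λ' k₁ k₂ l} {I J : Inc np nl} → J ⊆ᴵ I → Sparse λ' k₁ k₂ l I → Sparse λ' k₁ k₂ l J
  Sparse-⊆ J⊆I sp K K⊆J = sp K (λ p l e → J⊆I p l (K⊆J p l e))

  sparse-bound : ∀ λ' k₁ k₂ l → l ≤ k₁ + k₂ → (I : Inc np nl) → Sparse λ' k₁ k₂ l I →
    (P : Subset np) (L : Subset nl) (J : Inc np nl) → Subgeometry I P L J →
    Nonempty P → Nonempty L → λ' * size J + l ≤ k₁ * ∣ P ∣ + k₂ * ∣ L ∣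
  sparse-bound λ' k₁ k₂ l l≤k I sp P L J (J⊆I , inPL) (_ , x∈P) (_ , y∈L)
    with size≡0⊎NonemptyI J
  ... | inj₂ ne = ≤-trans (sp J J⊆I ne)
                    (weight-mono k₁ k₂ (p⊆q⇒∣p∣≤∣q∣ (pts-⊆ J P (λ p l e → proj₁ (inPL p l e))))
                                       (p⊆q⇒∣p∣≤∣q∣ (lns-⊆ J L (λ p l e → proj₂ (inPL p l e)))))
  ... | inj₁ eq = begin
    λ' * size J + l         ≡⟨ cong (λ s → λ' * s + l) eq ⟩
    λ' * 0 + l              ≡⟨ cong (_+ l) (*-zeroʳ λ') ⟩
    l                       ≤⟨ l≤k ⟩
    k₁ + k₂                 ≡⟨ cong₂ _+_ (*-identityʳ k₁) (*-identityʳ k₂) ⟨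
    k₁ * 1 + k₂ * 1         ≤⟨ weight-mono k₁ k₂ (x∈p⇒0<∣p∣ x∈P) (x∈p⇒0<∣p∣ y∈L) ⟩
    k₁ * ∣ P ∣ + k₂ * ∣ L ∣ ∎
    where open ≤-Reasoning

  restrict-⊆ᴵ : (I : Inc np nl) (P : Subset np) (L : Subset nl) → restrict I P L ⊆ᴵ I
  restrict-⊆ᴵ I P L p l e with I p l
  ... | true = refl

  restrict-Subgeometry : (I : Inc np nl) (P : Subset np) (L : Subset nl) →
                         Subgeometry I P L (restrict I P L)
  restrict-Subgeometry I P L = restrict-⊆ᴵ I P L , inside
    where
    inside : ∀ p l → restrict I P L p l ≡ true → lookup P p ≡ true × lookup L l ≡ true
    inside p l e with I p l | lookup P p | lookup L l
    ... | true | true | true = refl , refl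

  restrict-intro : (I : Inc np nl) (P : Subset np) (L : Subset nl) → ∀ {p l} →
    I p l ≡ true → lookup P p ≡ true → lookup L l ≡ true → restrict I P L p l ≡ true
  restrict-intro I P L Ipl Pp Ll rewrite Ipl | Pp | Ll = refl

  restrict-Block : ∀ λ' k₁ k₂ l (I : Inc np nl) → Sparse λ' k₁ k₂ l I →
    (P : Subset np) (L : Subset nl) →
    λ' * size (restrict I P L) + l ≡ k₁ * ∣ P ∣ + k₂ * ∣ L ∣ →
    Block λ' k₁ k₂ l I P L (restrict I P L)
  restrict-Block λ' k₁ k₂ l I sp P L tight =
    restrict-Subgeometry I P L , Sparse-⊆ {λ'} {k₁} {k₂} {l} (restrict-⊆ᴵ I P L) sp , tight

  size-supermodular : (I : Inc np nl) (P₁ P₂ : Subset np) (L₁ L₂ : Subset nl) (I₁ I₂ : Inc np nl) →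
    Subgeometry I P₁ L₁ I₁ → Subgeometry I P₂ L₂ I₂ →
    size I₁ + size I₂ ≤ size (restrict I (P₁ ∪ P₂) (L₁ ∪ L₂)) + size (restrict I (P₁ ∩ P₂) (L₁ ∩ L₂))
  size-supermodular I P₁ P₂ L₁ L₂ I₁ I₂ (I₁⊆I , in₁) (I₂⊆I , in₂) =
    size-+-mono I₁ I₂ I∪ I∩ pointwise
    where
    I∪ I∩ : Inc np nl
    I∪ = restrict I (P₁ ∪ P₂) (L₁ ∪ L₂)
    I∩ = restrict I (P₁ ∩ P₂) (L₁ ∩ L₂)
    pointwise : ∀ p l →
                indicator (I₁ p l) + indicator (I₂ p l) ≤ indicator (I∪ p l) + indicator (I∩ p l)
    pointwise p l = indicator-+-mono (I₁ p l) (I₂ p l) (I∪ p l) (I∩ p l)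
      (λ e → restrict-intro I (P₁ ∪ P₂) (L₁ ∪ L₂) (I₁⊆I p l e)
               (lookup-∪ˡ P₁ P₂ (proj₁ (in₁ p l e))) (lookup-∪ˡ L₁ L₂ (proj₂ (in₁ p l e))))
      (λ e → restrict-intro I (P₁ ∪ P₂) (L₁ ∪ L₂) (I₂⊆I p l e)
               (lookup-∪ʳ P₁ P₂ (proj₁ (in₂ p l e))) (lookup-∪ʳ L₁ L₂ (proj₂ (in₂ p l e))))
      (λ e f → restrict-intro I (P₁ ∩ P₂) (L₁ ∩ L₂) (I₁⊆I p l e)
                 (lookup-∩ P₁ P₂ (proj₁ (in₁ p l e)) (proj₁ (in₂ p l f)))
                 (lookup-∩ L₁ L₂ (proj₂ (in₁ p l e)) (proj₂ (in₂ p l f))))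

  blocks-∪∩-weight-≤ : ∀ λ' k₁ k₂ l (I : Inc np nl) (P₁ P₂ : Subset np) (L₁ L₂ : Subset nl)
    (I₁ I₂ : Inc np nl) → Block λ' k₁ k₂ l I P₁ L₁ I₁ → Block λ' k₁ k₂ l I P₂ L₂ I₂ →
    (k₁ * ∣ P₁ ∪ P₂ ∣ + k₂ * ∣ L₁ ∪ L₂ ∣) + (k₁ * ∣ P₁ ∩ P₂ ∣ + k₂ * ∣ L₁ ∩ L₂ ∣)
    ≤ (λ' * size (restrict I (P₁ ∪ P₂) (L₁ ∪ L₂)) + l) + (λ' * size (restrict I (P₁ ∩ P₂) (L₁ ∩ L₂)) + l)
  blocks-∪∩-weight-≤ λ' k₁ k₂ l I P₁ P₂ L₁ L₂ I₁ I₂ (sub₁ , _ , tight₁) (sub₂ , _ , tight₂) = begin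
    (k₁ * ∣ P₁ ∪ P₂ ∣ + k₂ * ∣ L₁ ∪ L₂ ∣) + (k₁ * ∣ P₁ ∩ P₂ ∣ + k₂ * ∣ L₁ ∩ L₂ ∣)
      ≡⟨ weight-modular k₁ k₂ P₁ P₂ L₁ L₂ ⟩
    (k₁ * ∣ P₁ ∣ + k₂ * ∣ L₁ ∣) + (k₁ * ∣ P₂ ∣ + k₂ * ∣ L₂ ∣)
      ≡⟨ cong₂ _+_ tight₁ tight₂ ⟨
    (λ' * size I₁ + l) + (λ' * size I₂ + l)
      ≤⟨ affine-+-mono λ' l (size-supermodular I P₁ P₂ L₁ L₂ I₁ I₂ sub₁ sub₂) ⟩
    (λ' * size (restrict I (P₁ ∪ P₂) (L₁ ∪ L₂)) + l) + (λ' * size (restrict I (P₁ ∩ P₂) (L₁ ∩ L₂)) + l) ∎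
    where open ≤-Reasoning

lemma5 : (λ' k₁ k₂ l : ℕ) → l + λ' ≤ k₁ + k₂ →
    {np nl : ℕ} (I : Inc np nl) → Sparse λ' k₁ k₂ l I →
    (P₁ P₂ : Subset np) (L₁ L₂ : Subset nl) (I₁ I₂ : Inc np nl) →
    Block λ' k₁ k₂ l I P₁ L₁ I₁ → Block λ' k₁ k₂ l I P₂ L₂ I₂ →
    Nonempty (P₁ ∩ P₂) → Nonempty (L₁ ∩ L₂) →
    Block λ' k₁ k₂ l I (P₁ ∪ P₂) (L₁ ∪ L₂) (restrict I (P₁ ∪ P₂) (L₁ ∪ L₂))
    × Block λ' k₁ k₂ l I (P₁ ∩ P₂) (L₁ ∩ L₂) (restrict I (P₁ ∩ P₂) (L₁ ∩ L₂))
lemma5 λ' k₁ k₂ l l+λ≤k {np} {nl} I sp P₁ P₂ L₁ L₂ I₁ I₂ B₁ B₂ (x , x∈P∩) (y , y∈L∩) =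
  restrict-Block λ' k₁ k₂ l I sp (P₁ ∪ P₂) (L₁ ∪ L₂) (proj₁ tight) ,
  restrict-Block λ' k₁ k₂ l I sp (P₁ ∩ P₂) (L₁ ∩ L₂) (proj₂ tight)
  where
  bound : (P : Subset np) (L : Subset nl) → Nonempty P → Nonempty L →
          λ' * size (restrict I P L) + l ≤ k₁ * ∣ P ∣ + k₂ * ∣ L ∣
  bound P L = sparse-bound λ' k₁ k₂ l (m+n≤o⇒m≤o l l+λ≤k) I sp P L _ (restrict-Subgeometry I P L)

  tight : λ' * size (restrict I (P₁ ∪ P₂) (L₁ ∪ L₂)) + l ≡ k₁ * ∣ P₁ ∪ P₂ ∣ + k₂ * ∣ L₁ ∪ L₂ ∣
        × λ' * size (restrict I (P₁ ∩ P₂) (L₁ ∩ L₂)) + l ≡ k₁ * ∣ P₁ ∩ P₂ ∣ + k₂ * ∣ L₁ ∩ L₂ ∣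
  tight = squeeze
    (bound (P₁ ∪ P₂) (L₁ ∪ L₂) (x , p⊆p∪q P₂ (p∩q⊆p P₁ P₂ x∈P∩)) (y , p⊆p∪q L₂ (p∩q⊆p L₁ L₂ y∈L∩)))
    (bound (P₁ ∩ P₂) (L₁ ∩ L₂) (x , x∈P∩) (y , y∈L∩))
    (blocks-∪∩-weight-≤ λ' k₁ k₂ l I P₁ P₂ L₁ L₂ I₁ I₂ B₁ B₂)
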